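{- Let $G=(V,E)$ be a connected thin spider with spider partition $(S,C,R)$. Then $Man(G)=S\cup R$, and $S\cup R$ is an optimal (minimum-size) MEG set of $G$; in particular $meg(G)=|Man(G)|=|S|+|R|$.
   Context: For a graph $G=(V,E)$, an edge $e$ is monitored by a pair of vertices $a,b$ if every shortest $a$–$b$ path contains $e$; a set $S'\subseteq V$ monitors $e$ if some pair of vertices of $S'$ monitors $e$. An MEG set of $G$ is a set monitoring every edge; $meg(G)$ is the minimum size of an MEG set. A vertex is mandatory if it belongs to every MEG set, and $Man(G)$ is the set of mandatory vertices. A spider is a graph whose vertex set admits a partition into $S,C,R$ such that $C=\{c_1,\dots,c_l\}$ ($l\ge 2$) is a clique, $S=\{s_1,\dots,s_l\}$ is a stable set, and every vertex of $R$ is adjacent to every vertex of $C$ and to no vertex of $S$ (edges inside $R$ are unrestricted; $R$ may be empty). It is a thin spider if $N_C(s_i)=\{c_i\}$ for every $i$, and a thick spider if $N_C(s_i)=C\setminus\{c_i\}$ for every $i$. -}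

module Defs where

open import Data.Nat using (ℕ; zero; suc; _≤_; _+_)
open import Data.Bool using (Bool; true; false)
open import Data.Fin using (Fin)
open import Data.Fin.Subset using (Subset; _∈_; _∉_; _∪_; ∣_∣)
open import Data.Fin.Properties using (_≟_; any?)
open import Data.Vec using (tabulate)
open import Data.Empty using (⊥)
open import Data.Product using (Σ; ∃; ∃-syntax; _×_; _,_)
open import Data.Sum using (_⊎_)
open import Relation.Nullary using (¬_)
open import Relation.Nullary.Decidable using (⌊_⌋)
open import Relation.Binary.PropositionalEquality using (_≡_; _≢_)
open import Function.Bundles using (_⇔_)
open import Function.Definitions using (Injective)

record Graph (n : ℕ) : Set where
  field
    adj    : Fin n → Fin n → Bool
    adj-sym    : ∀ u v → adj u v ≡ adj v u
    adj-irrefl : ∀ v → adj v v ≡ false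

module _ {n : ℕ} (G : Graph n) where
  open Graph G

  Adj : Fin n → Fin n → Set
  Adj u v = adj u v ≡ true

  data Walk : Fin n → Fin n → ℕ → Set where
    here : ∀ a → Walk a a 0
    step : ∀ {b c k} a → Adj a b → Walk b c k → Walk a c (suc k)

  UsesEdge : ∀ {a b k} → Walk a b k → Fin n → Fin n → Set
  UsesEdge (here a) u v = ⊥
  UsesEdge (step {b} a _ w) u v =
    ((a ≡ u × b ≡ v) ⊎ (a ≡ v × b ≡ u)) ⊎ UsesEdge w u v

  -- a shortest a–b path: a walk of minimum length among all a–b walks
  -- (minimum-length walks are exactly the shortest paths)
  IsShortest : ∀ {a b k} → Walk a b k → Set
  IsShortest {a} {b} {k} w = ∀ k' → Walk a b k' → k ≤ k'

  Connected : Set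
  Connected = ∀ a b → ∃[ k ] Walk a b k

  Monitors : Fin n → Fin n → Fin n → Fin n → Set
  Monitors a b u v = ∀ k (w : Walk a b k) → IsShortest w → UsesEdge w u v

  SetMonitors : Subset n → Fin n → Fin n → Set
  SetMonitors X u v = ∃[ a ] ∃[ b ] (a ∈ X × b ∈ X × Monitors a b u v)

  IsMEG : Subset n → Set
  IsMEG X = ∀ u v → Adj u v → SetMonitors X u v

  IsOptimalMEG : Subset n → Set
  IsOptimalMEG X = IsMEG X × (∀ Y → IsMEG Y → ∣ X ∣ ≤ ∣ Y ∣)

  Mandatory : Fin n → Set
  Mandatory v = ∀ X → IsMEG X → v ∈ X

  record SpiderPartition (l : ℕ) (s c : Fin l → Fin n) (R : Subset n) : Set where
    field
      l≥2      : 2 ≤ l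
      s-inj    : Injective _≡_ _≡_ s
      c-inj    : Injective _≡_ _≡_ c
      s≢c      : ∀ i j → s i ≢ c j
      s∉R      : ∀ i → s i ∉ R
      c∉R      : ∀ i → c i ∉ R
      cover    : ∀ v → v ∈ R ⊎ (∃[ i ] v ≡ s i) ⊎ (∃[ i ] v ≡ c i)
      C-clique : ∀ i j → i ≢ j → Adj (c i) (c j)
      S-stable : ∀ i j → ¬ Adj (s i) (s j)
      R-C      : ∀ v → v ∈ R → ∀ j → Adj v (c j)
      R-S      : ∀ v → v ∈ R → ∀ j → ¬ Adj v (s j)

  IsThin : ∀ {l} → (Fin l → Fin n) → (Fin l → Fin n) → Set
  IsThin s c = ∀ i j → (Adj (s i) (c j) ⇔ i ≡ j)

image : ∀ {l n} → (Fin l → Fin n) → Subset n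
image f = tabulate (λ v → ⌊ any? (λ i → f i ≟ v) ⌋)

-- A vertex u with a neighbour v such that N(u) ⊆ N[v] is mandatory: a shortest path that used
-- the edge uv and continued past u could be shortcut through v, so every pair monitoring uv
-- contains u. In a thin spider this applies to each pendant s_i (with v = c_i) and to each
-- r ∈ R (with v any vertex of C). Conversely S ∪ R monitors every edge: an edge inside R by its
-- ends, r c_j by r and s_j, the pendant edge s_i c_i by s_i and any other s_j, and c_i c_j by
-- s_i and s_j. A MEG set of mandatory vertices is both the set of all mandatory vertices and
-- optimal.
module Submission where

open import Defs
open import Data.Nat using (ℕ; zero; suc; _+_; _≤_; _<_; s≤s; s≤s⁻¹)
open import Data.Nat.Properties
  using (anyUpTo?; ≮⇒≥; <⇒≱; <⇒≤; n<1+n; n≤1+n; m<n⇒m<1+n; ≤-refl; m≤n⇒m≤1+n; +-suc)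
open import Data.Nat.Induction using (<-rec)
open import Data.Bool using (true; false)
import Data.Bool.Properties as Bool
open import Data.Fin using (Fin; zero; suc; fromℕ<; punchIn)
open import Data.Fin.Properties using (_≟_; any?; punchInᵢ≢i; suc-injective)
open import Data.Fin.Subset using (Subset; _∈_; _∉_; _∪_; _∩_; ∣_∣; ⁅_⁆; Empty)
open import Data.Fin.Subset.Properties
  using (x∈p∪q⁻; x∈p∪q⁺; x∈p∩q⁻; x∈⁅x⁆; x∈⁅y⁆⇒x≡y; ∣⁅x⁆∣≡1; ∣⊥∣≡0; drop-∷-Empty; Empty-unique;
         ⊆-antisym; p⊆q⇒∣p∣≤∣q∣)
open import Data.Vec using (_∷_; []; here)
open import Data.Vec.Properties using (lookup∘tabulate; []=⇒lookup; lookup⇒[]=)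
open import Data.Empty using (⊥-elim)
open import Data.Product using (Σ; ∃; _×_; _,_; proj₂)
open import Data.Sum using (_⊎_; inj₁; inj₂)
open import Function using (_∘_)
open import Relation.Nullary using (¬_; Dec; yes; no)
open import Relation.Nullary.Decidable using (map′; _×-dec_; toWitness; fromWitness)
open import Relation.Binary.PropositionalEquality
  using (_≡_; _≢_; refl; sym; trans; cong; cong₂; module ≡-Reasoning)
open import Function.Bundles using (_⇔_; mk⇔; Equivalence)
open import Function.Definitions using (Injective)

module _ {P : ℕ → Set} (P? : ∀ k → Dec (P k)) where

  Least : Set
  Least = ∃ λ k → P k × (∀ {j} → P j → k ≤ j)

  least-witness : ∀ {K} → P K → Least
  least-witness {K} = <-rec (λ K → P K → Least) least K
    where
      least : ∀ K → (∀ {J} → J < K → P J → Least) → P K → Least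
      least K smaller pK with anyUpTo? P? K
      ... | yes (J , J<K , pJ) = smaller J<K pJ
      ... | no none            = K , pK , λ pj → ≮⇒≥ (λ j<K → none (_ , j<K , pj))

∈-image⁺ : ∀ {l n} (f : Fin l → Fin n) i → f i ∈ image f
∈-image⁺ f i = lookup⇒[]= (f i) (image f)
  (trans (lookup∘tabulate _ (f i)) (Equivalence.to Bool.T-≡ (fromWitness (i , refl))))

∈-image⁻ : ∀ {l n} (f : Fin l → Fin n) {v} → v ∈ image f → ∃ λ i → f i ≡ v
∈-image⁻ f {v} v∈ =
  toWitness (Equivalence.from Bool.T-≡ (trans (sym (lookup∘tabulate _ v)) ([]=⇒lookup v∈)))

∣p∪q∣≡∣p∣+∣q∣ : ∀ {n} (p q : Subset n) → Empty (p ∩ q) → ∣ p ∪ q ∣ ≡ ∣ p ∣ + ∣ q ∣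
∣p∪q∣≡∣p∣+∣q∣ []          []          _ = refl
∣p∪q∣≡∣p∣+∣q∣ (true ∷ p)  (true ∷ q)  e = ⊥-elim (e (zero , here))
∣p∪q∣≡∣p∣+∣q∣ (true ∷ p)  (false ∷ q) e = cong suc (∣p∪q∣≡∣p∣+∣q∣ p q (drop-∷-Empty e))
∣p∪q∣≡∣p∣+∣q∣ (false ∷ p) (true ∷ q)  e =
  trans (cong suc (∣p∪q∣≡∣p∣+∣q∣ p q (drop-∷-Empty e))) (sym (+-suc ∣ p ∣ ∣ q ∣))
∣p∪q∣≡∣p∣+∣q∣ (false ∷ p) (false ∷ q) e = ∣p∪q∣≡∣p∣+∣q∣ p q (drop-∷-Empty e)

image-suc : ∀ {l n} (f : Fin (suc l) → Fin n) → image f ≡ ⁅ f zero ⁆ ∪ image (f ∘ suc)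
image-suc f = ⊆-antisym ⊆ ⊇
  where
    ⊆ : ∀ {v} → v ∈ image f → v ∈ ⁅ f zero ⁆ ∪ image (f ∘ suc)
    ⊆ v∈ with ∈-image⁻ f v∈
    ... | zero  , refl = x∈p∪q⁺ (inj₁ (x∈⁅x⁆ (f zero)))
    ... | suc i , refl = x∈p∪q⁺ (inj₂ (∈-image⁺ (f ∘ suc) i))
    ⊇ : ∀ {v} → v ∈ ⁅ f zero ⁆ ∪ image (f ∘ suc) → v ∈ image f
    ⊇ v∈ with x∈p∪q⁻ ⁅ f zero ⁆ (image (f ∘ suc)) v∈
    ... | inj₁ v∈⁅f0⁆ rewrite x∈⁅y⁆⇒x≡y (f zero) v∈⁅f0⁆ = ∈-image⁺ f zero
    ... | inj₂ v∈img with ∈-image⁻ (f ∘ suc) v∈img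
    ...   | i , refl = ∈-image⁺ f (suc i)

∣image∣≡ : ∀ {l n} (f : Fin l → Fin n) → Injective _≡_ _≡_ f → ∣ image f ∣ ≡ l
∣image∣≡ {zero} {n} f _ =
  trans (cong ∣_∣ (Empty-unique λ { (_ , v∈) → no-index v∈ })) (∣⊥∣≡0 n)
  where
    no-index : ∀ {v} → v ∉ image f
    no-index v∈ with ∈-image⁻ f v∈
    ... | () , _
∣image∣≡ {suc l} f f-inj = begin
  ∣ image f ∣                          ≡⟨ cong ∣_∣ (image-suc f) ⟩
  ∣ ⁅ f zero ⁆ ∪ image (f ∘ suc) ∣     ≡⟨ ∣p∪q∣≡∣p∣+∣q∣ ⁅ f zero ⁆ (image (f ∘ suc)) disjoint ⟩
  ∣ ⁅ f zero ⁆ ∣ + ∣ image (f ∘ suc) ∣ ≡⟨ cong₂ _+_ (∣⁅x⁆∣≡1 (f zero))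
                                                  (∣image∣≡ (f ∘ suc) (suc-injective ∘ f-inj)) ⟩
  suc l                                ∎
  where
    open ≡-Reasoning
    disjoint : Empty (⁅ f zero ⁆ ∩ image (f ∘ suc))
    disjoint (v , v∈) with x∈p∩q⁻ ⁅ f zero ⁆ (image (f ∘ suc)) v∈
    ... | v∈⁅f0⁆ , v∈img with x∈⁅y⁆⇒x≡y (f zero) v∈⁅f0⁆ | ∈-image⁻ (f ∘ suc) v∈img
    ...   | refl | i , f[1+i]≡f0 with f-inj f[1+i]≡f0
    ...     | ()

module _ {n} (G : Graph n) where
  open Graph G

  Adj-sym : ∀ {u v} → Adj G u v → Adj G v u
  Adj-sym {u} {v} p = trans (adj-sym v u) p

  Adj⇒≢ : ∀ {u v} → Adj G u v → u ≢ v
  Adj⇒≢ {u} p refl with trans (sym p) (adj-irrefl u)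
  ... | ()

  Adj? : ∀ u v → Dec (Adj G u v)
  Adj? u v = adj u v Bool.≟ true

  N[_] : Fin n → Fin n → Set
  N[ v ] x = x ≡ v ⊎ Adj G v x

  N[]-sym : ∀ {u v} → N[ v ] u → N[ u ] v
  N[]-sym (inj₁ refl) = inj₁ refl
  N[]-sym (inj₂ p)    = inj₂ (Adj-sym p)

  UsesEdge-sym : ∀ {a b k u v} (w : Walk G a b k) → UsesEdge G w u v → UsesEdge G w v u
  UsesEdge-sym (step _ _ w) (inj₁ (inj₁ e)) = inj₁ (inj₂ e)
  UsesEdge-sym (step _ _ w) (inj₁ (inj₂ e)) = inj₁ (inj₁ e)
  UsesEdge-sym (step _ _ w) (inj₂ uses)     = inj₂ (UsesEdge-sym w uses)

  SetMonitors-sym : ∀ {X u v} → SetMonitors G X u v → SetMonitors G X v u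
  SetMonitors-sym (a , b , a∈X , b∈X , monitors) =
    a , b , a∈X , b∈X , λ k w sh → UsesEdge-sym w (monitors k w sh)

  UsesEdge⇒suffix : ∀ {a b k u v} (w : Walk G a b k) → UsesEdge G w u v →
                    ∃ λ k' → k' ≤ k × Walk G u b k'
  UsesEdge⇒suffix (step _ p w) (inj₁ (inj₁ (refl , _))) = _ , ≤-refl , step _ p w
  UsesEdge⇒suffix (step _ _ w) (inj₁ (inj₂ (_ , refl))) = _ , n≤1+n _ , w
  UsesEdge⇒suffix (step _ _ w) (inj₂ uses) with UsesEdge⇒suffix w uses
  ... | k' , k'≤k , suffix = k' , m≤n⇒m≤1+n k'≤k , suffix

  Walk? : ∀ k a b → Dec (Walk G a b k)
  Walk? zero    a b = map′ (λ { refl → here a }) (λ { (here _) → refl }) (a ≟ b)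
  Walk? (suc k) a b = map′ (λ (_ , p , w) → step a p w) (λ { (step _ p w) → _ , p , w })
                           (any? λ x → Adj? a x ×-dec Walk? k x b)

  shortest-walk : Connected G → ∀ a b → ∃ λ k → Σ (Walk G a b k) (IsShortest G)
  shortest-walk con a b with least-witness (λ k → Walk? k a b) (proj₂ (con a b))
  ... | k , w , minimal = k , w , λ _ w' → minimal w'

  shortest-tail : ∀ {a b c k} (p : Adj G a b) (w : Walk G b c k) →
                  IsShortest G (step a p w) → IsShortest G w
  shortest-tail p w sh k' w' = s≤s⁻¹ (sh (suc k') (step _ p w'))

  shortest-no-shortcut : ∀ {x u y b k} (p : Adj G x u) (q : Adj G u y) (w : Walk G y b k) →
                         IsShortest G (step x p (step u q w)) → ¬ N[ x ] y
  shortest-no-shortcut p q w sh (inj₁ refl) = <⇒≱ (m<n⇒m<1+n (n<1+n _)) (sh _ w)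
  shortest-no-shortcut p q w sh (inj₂ xy)   = <⇒≱ (n<1+n _) (sh _ (step _ xy w))

  shortest-first-edge : ∀ {u v y b k} (q : Adj G u y) (w : Walk G y b k) → IsShortest G (step u q w) →
                        u ≢ v → UsesEdge G (step u q w) u v → y ≡ v
  shortest-first-edge q w sh u≢v (inj₁ (inj₁ (_ , y≡v))) = y≡v
  shortest-first-edge q w sh u≢v (inj₁ (inj₂ (u≡v , _))) = ⊥-elim (u≢v u≡v)
  shortest-first-edge q w sh u≢v (inj₂ uses) with UsesEdge⇒suffix w uses
  ... | k' , k'≤k , suffix = ⊥-elim (<⇒≱ (s≤s k'≤k) (sh k' suffix))

  module _ {u v} (uv : Adj G u v) (dominated : ∀ {x} → Adj G u x → N[ v ] x) where

    private
      no-return : ∀ {a b k} (p : Adj G a u) (w : Walk G u b k) →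
                  IsShortest G (step a p w) → ¬ UsesEdge G w u v
      no-return p (step _ q w) sh uses
        with shortest-first-edge q w (shortest-tail p (step _ q w) sh) (Adj⇒≢ uv) uses
      ... | refl = shortest-no-shortcut p q w sh (N[]-sym (dominated (Adj-sym p)))

    shortest-edge-endpoint : ∀ {a b k} (w : Walk G a b k) → IsShortest G w →
                             UsesEdge G w u v → a ≡ u ⊎ b ≡ u
    shortest-edge-endpoint (step _ _ w)            sh (inj₁ (inj₁ (a≡u , _))) = inj₁ a≡u
    shortest-edge-endpoint (step _ _ (here _))     sh (inj₁ (inj₂ (_ , refl))) = inj₂ refl
    shortest-edge-endpoint (step _ p (step _ q w)) sh (inj₁ (inj₂ (refl , refl))) =
      ⊥-elim (shortest-no-shortcut p q w sh (dominated q))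
    shortest-edge-endpoint (step _ p w) sh (inj₂ uses)
      with shortest-edge-endpoint w (shortest-tail p w sh) uses
    ... | inj₁ refl = ⊥-elim (no-return p w sh uses)
    ... | inj₂ b≡u  = inj₂ b≡u

    dominated⇒mandatory : Connected G → Mandatory G u
    dominated⇒mandatory con X X-MEG with X-MEG u v uv
    ... | a , b , a∈X , b∈X , monitors with shortest-walk con a b
    ...   | k , w , sh with shortest-edge-endpoint w sh (monitors k w sh)
    ...     | inj₁ refl = a∈X
    ...     | inj₂ refl = b∈X

  short-walks-monitor : ∀ {a b d u v} → Walk G a b d →
                        (∀ {k} (w : Walk G a b k) → k ≤ d → UsesEdge G w u v) → Monitors G a b u v
  short-walks-monitor witness uses _ w sh = uses w (sh _ witness)

  walk≤1-uses-edge : ∀ {a b k} → Adj G a b → (w : Walk G a b k) → k ≤ 1 → UsesEdge G w a b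
  walk≤1-uses-edge ab (here _)             _         = ⊥-elim (Adj⇒≢ ab refl)
  walk≤1-uses-edge ab (step _ _ (here _))  _         = inj₁ (inj₁ (refl , refl))
  walk≤1-uses-edge ab (step _ _ (step _ _ _)) (s≤s ())

  adjacent-monitors : ∀ {a b} → Adj G a b → Monitors G a b a b
  adjacent-monitors ab = short-walks-monitor (step _ ab (here _)) (walk≤1-uses-edge ab)

  pendant-monitors : ∀ {a t b} → (∀ {x} → Adj G a x → x ≡ t) → b ≢ a → Monitors G a b a t
  pendant-monitors only-t b≢a _ (here _)     _ = ⊥-elim (b≢a refl)
  pendant-monitors only-t b≢a _ (step _ p _) _ = inj₁ (inj₁ (refl , only-t p))

module _ {n} (G : Graph n) {X : Subset n}
         (X-MEG : IsMEG G X) (X-mandatory : ∀ {v} → v ∈ X → Mandatory G v) where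

  Mandatory⇔∈ : ∀ v → Mandatory G v ⇔ v ∈ X
  Mandatory⇔∈ v = mk⇔ (λ v-mandatory → v-mandatory X X-MEG) X-mandatory

  mandatory-MEG⇒optimal : IsOptimalMEG G X
  mandatory-MEG⇒optimal = X-MEG , λ Y Y-MEG → p⊆q⇒∣p∣≤∣q∣ (λ v∈X → X-mandatory v∈X Y Y-MEG)

module ThinSpider {n} {G : Graph n} {l} {s c : Fin l → Fin n} {R : Subset n}
                  (sp : SpiderPartition G l s c R) (thin : IsThin G s c) where
  open SpiderPartition sp

  s-c : ∀ i → Adj G (s i) (c i)
  s-c i = Equivalence.from (thin i i) refl

  c-s : ∀ i → Adj G (c i) (s i)
  c-s i = Adj-sym G (s-c i)

  s-pendant : ∀ j {x} → Adj G (s j) x → x ≡ c j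
  s-pendant j {x} p with cover x
  ... | inj₁ x∈R               = ⊥-elim (R-S x x∈R j (Adj-sym G p))
  ... | inj₂ (inj₁ (i , refl)) = ⊥-elim (S-stable j i p)
  ... | inj₂ (inj₂ (i , refl)) = cong c (sym (Equivalence.to (thin j i) p))

  another-index : (i : Fin l) → ∃ λ j → j ≢ i
  another-index i with l≥2
  ... | s≤s (s≤s _) = punchIn i zero , punchInᵢ≢i i zero

  S-mandatory : Connected G → ∀ i → Mandatory G (s i)
  S-mandatory con i = dominated⇒mandatory G (s-c i) (inj₁ ∘ s-pendant i) con

  R-mandatory : Connected G → ∀ {r} → r ∈ R → Mandatory G r
  R-mandatory con {r} r∈R = dominated⇒mandatory G (R-C r r∈R i₀) dominated con
    where
      i₀ : Fin l
      i₀ = fromℕ< (<⇒≤ l≥2)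
      dominated : ∀ {x} → Adj G r x → N[_] G (c i₀) x
      dominated {x} p with cover x
      ... | inj₁ x∈R               = inj₂ (Adj-sym G (R-C x x∈R i₀))
      ... | inj₂ (inj₁ (j , refl)) = ⊥-elim (R-S r r∈R j p)
      ... | inj₂ (inj₂ (j , refl)) with j ≟ i₀
      ...   | yes refl = inj₁ refl
      ...   | no j≢i₀  = inj₂ (C-clique i₀ j (j≢i₀ ∘ sym))

  S∪R-mandatory : Connected G → ∀ {v} → v ∈ image s ∪ R → Mandatory G v
  S∪R-mandatory con v∈ with x∈p∪q⁻ (image s) R v∈
  ... | inj₂ v∈R = R-mandatory con v∈R
  ... | inj₁ v∈S with ∈-image⁻ s v∈S
  ...   | i , refl = S-mandatory con i

  walk≤2-R-S : ∀ {r j k} → r ∈ R → (w : Walk G r (s j) k) → k ≤ 2 → UsesEdge G w r (c j)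
  walk≤2-R-S {j = j} r∈R (here _)                      _ = ⊥-elim (s∉R j r∈R)
  walk≤2-R-S {j = j} r∈R (step _ p (here _))           _ = ⊥-elim (R-S _ r∈R j p)
  walk≤2-R-S {j = j} r∈R (step _ _ (step _ q (here _))) _ =
    inj₁ (inj₁ (refl , s-pendant j (Adj-sym G q)))
  walk≤2-R-S r∈R (step _ _ (step _ _ (step _ _ _))) (s≤s (s≤s ()))

  -- The endpoints are kept as variables a, b because the unifier cannot solve s i ≟ s j.
  walk≤3-S-S : ∀ {i j a b k} → i ≢ j → a ≡ s i → b ≡ s j → (w : Walk G a b k) → k ≤ 3 →
               UsesEdge G w (c i) (c j)
  walk≤3-S-S i≢j refl b≡sj (here _) _ = ⊥-elim (i≢j (s-inj b≡sj))
  walk≤3-S-S {i} {j} i≢j refl refl (step _ p (here _)) _ = ⊥-elim (S-stable i j p)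
  walk≤3-S-S {i} {j} i≢j refl refl (step _ p (step _ q (here _))) _ =
    ⊥-elim (i≢j (c-inj (trans (sym (s-pendant i p)) (s-pendant j (Adj-sym G q)))))
  walk≤3-S-S {i} {j} i≢j refl refl (step _ p (step _ _ (step _ q (here _)))) _ =
    inj₂ (inj₁ (inj₁ (s-pendant i p , s-pendant j (Adj-sym G q))))
  walk≤3-S-S i≢j _ _ (step _ _ (step _ _ (step _ _ (step _ _ _)))) (s≤s (s≤s (s≤s ())))

  s∈S∪R : ∀ i → s i ∈ image s ∪ R
  s∈S∪R i = x∈p∪q⁺ (inj₁ (∈-image⁺ s i))

  R⊆S∪R : ∀ {r} → r ∈ R → r ∈ image s ∪ R
  R⊆S∪R r∈R = x∈p∪q⁺ (inj₂ r∈R)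

  R-edge-monitored : ∀ {r v} → r ∈ R → Adj G r v → SetMonitors G (image s ∪ R) r v
  R-edge-monitored {r} {v} r∈R rv with cover v
  ... | inj₁ v∈R               = r , v , R⊆S∪R r∈R , R⊆S∪R v∈R , adjacent-monitors G rv
  ... | inj₂ (inj₁ (j , refl)) = ⊥-elim (R-S r r∈R j rv)
  ... | inj₂ (inj₂ (j , refl)) =
    r , s j , R⊆S∪R r∈R , s∈S∪R j ,
    short-walks-monitor G (step r (R-C r r∈R j) (step (c j) (c-s j) (here (s j)))) (walk≤2-R-S r∈R)

  S-edge-monitored : ∀ i {v} → Adj G (s i) v → SetMonitors G (image s ∪ R) (s i) v
  S-edge-monitored i p with s-pendant i p | another-index i
  ... | refl | j , j≢i =
    s i , s j , s∈S∪R i , s∈S∪R j , pendant-monitors G (s-pendant i) (j≢i ∘ s-inj)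

  C-C-edge-monitored : ∀ {i j} → i ≢ j → SetMonitors G (image s ∪ R) (c i) (c j)
  C-C-edge-monitored {i} {j} i≢j =
    s i , s j , s∈S∪R i , s∈S∪R j ,
    short-walks-monitor G
      (step (s i) (s-c i) (step (c i) (C-clique i j i≢j) (step (c j) (c-s j) (here (s j)))))
      (walk≤3-S-S i≢j refl refl)

  S∪R-MEG : IsMEG G (image s ∪ R)
  S∪R-MEG u v uv with cover u
  ... | inj₁ u∈R               = R-edge-monitored u∈R uv
  ... | inj₂ (inj₁ (i , refl)) = S-edge-monitored i uv
  ... | inj₂ (inj₂ (i , refl)) with cover v
  ...   | inj₁ v∈R               = SetMonitors-sym G (R-edge-monitored v∈R (Adj-sym G uv))
  ...   | inj₂ (inj₁ (j , refl)) = SetMonitors-sym G (S-edge-monitored j (Adj-sym G uv))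
  ...   | inj₂ (inj₂ (j , refl)) = C-C-edge-monitored λ { refl → Adj⇒≢ G uv refl }

  ∣S∪R∣≡l+∣R∣ : ∣ image s ∪ R ∣ ≡ l + ∣ R ∣
  ∣S∪R∣≡l+∣R∣ = trans (∣p∪q∣≡∣p∣+∣q∣ (image s) R disjoint) (cong (_+ ∣ R ∣) (∣image∣≡ s s-inj))
    where
      disjoint : Empty (image s ∩ R)
      disjoint (v , v∈) with x∈p∩q⁻ (image s) R v∈
      ... | v∈S , v∈R with ∈-image⁻ s v∈S
      ...   | i , refl = s∉R i v∈R

mainTheorem2 : ∀ {n} (G : Graph n) (l : ℕ) (s c : Fin l → Fin n) (R : Subset n) →
    SpiderPartition G l s c R → IsThin G s c → Connected G →
    (∀ v → (Mandatory G v ⇔ v ∈ (image s ∪ R)))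
    × IsOptimalMEG G (image s ∪ R)
    × ∣ image s ∪ R ∣ ≡ l + ∣ R ∣
mainTheorem2 G l s c R sp thin con =
  Mandatory⇔∈ G S∪R-MEG S∪R⊆Man , mandatory-MEG⇒optimal G S∪R-MEG S∪R⊆Man , ∣S∪R∣≡l+∣R∣
  where
    open ThinSpider sp thin
    S∪R⊆Man : ∀ {v} → v ∈ image s ∪ R → Mandatory G v
    S∪R⊆Man = S∪R-mandatory con
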